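{- If $f:\mathfrak A\to\mathfrak B$ is an elementary team embedding, then it is an independence team embedding: for every formula $\phi(v_0,\dots,v_{n-1})$ of $\mathrm{FOIL}$ and every $X\subseteq\mathfrak A^n$, if $\mathfrak A\models_X\phi$ then $\mathfrak B\models_{f(X)}\phi$.
   Context: Team semantics: a team of $\mathfrak A$ with domain $D$ is a set of assignments $D\to\mathfrak A$. First-order formulas in negation normal form get team semantics: (negated) atoms hold iff they hold at every assignment; $\wedge$ componentwise; $\phi\vee\psi$ iff $X=Y\cup Z$ with $Y\models\phi$, $Z\models\psi$; $\exists x\phi$ iff $X(F/x)\models\phi$ for some $F:X\to\mathcal P(\mathfrak A)\setminus\{\emptyset\}$, where $X(F/x)=\{s(a/x):s\in X,a\in F(s)\}$; $\forall x\phi$ iff $X(\mathfrak A/x)\models\phi$. $\mathrm{FOIL}$ adds atoms $\vec x\perp_{\vec z}\vec y$: for all $s,s'\in X$ with $s(\vec z)=s'(\vec z)$ there is $s''\in X$ with $s''(\vec x\vec z)=s(\vec x\vec z)$, $s''(\vec y)=s'(\vec y)$. $\mathrm{FOT}$ has first-order atoms, inclusion atoms ($X[\vec x]\subseteq X[\vec y]$), constancy atoms ($|X[\vec x]|\le1$), weak classical negation ${\sim}\phi$ ($X=\emptyset$ or $\phi$ fails), classical $\wedge$ and disjunction, and $\exists^1x\phi$ / $\forall^1x\phi$ (some/every single element $a$ with $X(a/x)\models\phi$, $X(a/x)=\{s(a/x):s\in X\}$). An $n$-ary relation $X$ is identified with the team $\{\{(v_i,a_i):i<n\}:\vec a\in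 X\}$. For a structure $\mathfrak A$, $\mathcal R(\mathfrak A)=\bigcup_n\mathcal P(\mathfrak A^n)$. A team map $f:\mathfrak A\to\mathfrak B$ is an arity-preserving function $\mathcal R(\mathfrak A)\to\mathcal R(\mathfrak B)$ whose range is closed (contains $\emptyset$, all powers, the diagonal and symbol interpretations; closed under $\cap$, Cartesian product $\times$ of relations via tuple concatenation, coordinate projections/permutations). An elementary team embedding is a team map with $f(X\times Y)=f(X)\times f(Y)$ for all $X,Y$ and such that for every $\mathrm{FOT}$-formula $\phi(v_0,\dots,v_{n-1})$ and $X\subseteq\mathfrak A^n$, $\mathfrak A\models_X\phi$ iff $\mathfrak B\models_{f(X)}\phi$. -}

module Defs where

open import Level using (Level; Lift) renaming (suc to lsuc)
open import Data.Nat using (ℕ; zero; suc; _+_)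
open import Data.Fin using (Fin; zero; suc)
open import Data.Vec using (Vec; _∷_; []; head; tail; lookup; take; drop; tabulate; map)
open import Data.Product using (Σ; _×_; _,_; ∃)
open import Data.Sum using (_⊎_)
open import Data.Empty using (⊥)
open import Data.Unit using (⊤)
open import Relation.Nullary using (¬_)
open import Relation.Unary using (Pred; _≐_; _∩_)
open import Relation.Binary.PropositionalEquality using (_≡_)
open import Function.Definitions using (Injective)

record Signature : Set₁ where
  field
    FunSym : Set
    RelSym : Set
    funAr  : FunSym → ℕ
    relAr  : RelSym → ℕ
open Signature public

record Structure (σ : Signature) (ℓ : Level) : Set (lsuc ℓ) where
  field
    Carrier : Set ℓ
    funI    : (f : FunSym σ) → Vec Carrier (funAr σ f) → Carrier
    relI    : (R : RelSym σ) → Vec Carrier (relAr σ R) → Set ℓ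
open Structure public

-- Terms in scope n (variables v_0 … v_{n-1} are Fin n)
data Term (σ : Signature) (n : ℕ) : Set where
  var : Fin n → Term σ n
  app : (f : FunSym σ) → (Fin (funAr σ f) → Term σ n) → Term σ n

module _ {σ : Signature} {ℓ : Level} (𝔄 : Structure σ ℓ) where
  evalT : ∀ {n} → Vec (Carrier 𝔄) n → Term σ n → Carrier 𝔄
  evalT s (var i)    = lookup s i
  evalT s (app f ts) = funI 𝔄 f (tabulate (λ i → evalT s (ts i)))

data Literal (σ : Signature) (n : ℕ) : Set where
  rel   : (R : RelSym σ) → (Fin (relAr σ R) → Term σ n) → Literal σ n
  nrel  : (R : RelSym σ) → (Fin (relAr σ R) → Term σ n) → Literal σ n
  eq    : Term σ n → Term σ n → Literal σ n
  neq   : Term σ n → Term σ n → Literal σ n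

module _ {σ : Signature} {ℓ : Level} (𝔄 : Structure σ ℓ) where
  holdsLit : ∀ {n} → Vec (Carrier 𝔄) n → Literal σ n → Set ℓ
  holdsLit s (rel R ts)  = relI 𝔄 R (tabulate (λ i → evalT 𝔄 s (ts i)))
  holdsLit s (nrel R ts) = ¬ relI 𝔄 R (tabulate (λ i → evalT 𝔄 s (ts i)))
  holdsLit s (eq t u)    = evalT 𝔄 s t ≡ evalT 𝔄 s u
  holdsLit s (neq t u)   = ¬ (evalT 𝔄 s t ≡ evalT 𝔄 s u)

-- Teams.  A team over the variables v_0 … v_{n-1} is a subset of A^n,
-- i.e. a predicate on Vec A n.  Quantifiers bind a fresh variable,
-- which becomes position 0 (scoped de Bruijn syntax).

Team : ∀ {ℓ} → Set ℓ → ℕ → Set (lsuc ℓ)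
Team {ℓ} A n = Pred (Vec A n) ℓ

module _ {ℓ : Level} {A : Set ℓ} where
  supp1 : ∀ {n} → Team A n → A → Team A (suc n)
  supp1 X a t = (head t ≡ a) × X (tail t)

  duplicate : ∀ {n} → Team A n → Team A (suc n)
  duplicate X t = X (tail t)

  -- X(F/x), with F : X → P(A) given as a relation on assignments × A
  supplement : ∀ {n} → Team A n → (Vec A n → A → Set ℓ) → Team A (suc n)
  supplement X F t = X (tail t) × F (tail t) (head t)

  NonEmptyOn : ∀ {n} → Team A n → (Vec A n → A → Set ℓ) → Set ℓ
  NonEmptyOn X F = ∀ s → X s → ∃ λ a → F s a

  IsEmpty : ∀ {n} → Team A n → Set ℓ
  IsEmpty X = ∀ s → ¬ X s

  _[_] : ∀ {n k} → Vec A n → Vec (Fin n) k → Vec A k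
  s [ xs ] = map (lookup s) xs

data FOIL (σ : Signature) : ℕ → Set where
  lit  : ∀ {n} → Literal σ n → FOIL σ n
  indep : ∀ {n a b c} → Vec (Fin n) a → Vec (Fin n) c → Vec (Fin n) b → FOIL σ n
    -- indep xs zs ys  is  x⃗ ⊥_{z⃗} y⃗
  _∧_  : ∀ {n} → FOIL σ n → FOIL σ n → FOIL σ n
  _∨_  : ∀ {n} → FOIL σ n → FOIL σ n → FOIL σ n
  ex   : ∀ {n} → FOIL σ (suc n) → FOIL σ n
  all  : ∀ {n} → FOIL σ (suc n) → FOIL σ n

data FOT (σ : Signature) : ℕ → Set where
  lit  : ∀ {n} → Literal σ n → FOT σ n
  incl : ∀ {n k} → Vec (Fin n) k → Vec (Fin n) k → FOT σ n
    -- incl xs ys  is  X[x⃗] ⊆ X[y⃗]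
  const : ∀ {n k} → Vec (Fin n) k → FOT σ n
    -- |X[x⃗]| ≤ 1
  ~_   : ∀ {n} → FOT σ n → FOT σ n
  _∧_  : ∀ {n} → FOT σ n → FOT σ n → FOT σ n
  _⊔_  : ∀ {n} → FOT σ n → FOT σ n → FOT σ n
  ex1  : ∀ {n} → FOT σ (suc n) → FOT σ n
  all1 : ∀ {n} → FOT σ (suc n) → FOT σ n

module _ {σ : Signature} {ℓ : Level} (𝔄 : Structure σ ℓ) where
  private A = Carrier 𝔄

  litSat : ∀ {n} → Team A n → Literal σ n → Set ℓ
  litSat X α = ∀ s → X s → holdsLit 𝔄 s α

  SatFOIL : ∀ {n} → Team A n → FOIL σ n → Set (lsuc ℓ)
  SatFOIL X (lit α) = Lift (lsuc ℓ) (litSat X α)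
  SatFOIL X (indep xs zs ys) = Lift (lsuc ℓ)
    (∀ s s' → X s → X s' → s [ zs ] ≡ s' [ zs ] →
      ∃ λ s'' → X s'' × (s'' [ xs ] ≡ s [ xs ]) × (s'' [ zs ] ≡ s [ zs ])
                       × (s'' [ ys ] ≡ s' [ ys ]))
  SatFOIL X (φ ∧ ψ) = SatFOIL X φ × SatFOIL X ψ
  SatFOIL X (φ ∨ ψ) = Σ (Team A _) λ Y → Σ (Team A _) λ Z →
    (∀ s → (X s → Y s ⊎ Z s) × (Y s ⊎ Z s → X s)) × SatFOIL Y φ × SatFOIL Z ψ
  SatFOIL X (ex φ) = Σ (Vec A _ → A → Set ℓ) λ F →
    NonEmptyOn X F × SatFOIL (supplement X F) φ
  SatFOIL X (all φ) = SatFOIL (duplicate X) φ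

  SatFOT : ∀ {n} → Team A n → FOT σ n → Set (lsuc ℓ)
  SatFOT X (lit α) = Lift (lsuc ℓ) (litSat X α)
  SatFOT X (incl xs ys) = Lift (lsuc ℓ)
    (∀ s → X s → ∃ λ s' → X s' × (s' [ ys ] ≡ s [ xs ]))
  SatFOT X (const xs) = Lift (lsuc ℓ)
    (∀ s s' → X s → X s' → s [ xs ] ≡ s' [ xs ])
  SatFOT X (~ φ) = Lift (lsuc ℓ) (IsEmpty X) ⊎ ¬ SatFOT X φ
  SatFOT X (φ ∧ ψ) = SatFOT X φ × SatFOT X ψ
  SatFOT X (φ ⊔ ψ) = SatFOT X φ ⊎ SatFOT X ψ
  SatFOT X (ex1 φ) = Σ A λ a → SatFOT (supp1 X a) φ
  SatFOT X (all1 φ) = ∀ (a : A) → SatFOT (supp1 X a) φ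

module _ {ℓ : Level} {A : Set ℓ} where
  emptyRel : ∀ n → Team A n
  emptyRel n _ = Lift ℓ ⊥

  fullRel : ∀ n → Team A n
  fullRel n _ = Lift ℓ ⊤

  diagRel : Team A 2
  diagRel t = lookup t zero ≡ lookup t (suc zero)

  _×ᴿ_ : ∀ {n m} → Team A n → Team A m → Team A (n + m)
  _×ᴿ_ {n} X Y t = X (take n t) × Y (drop n t)

  reindex : ∀ {n m} → (Fin m → Fin n) → Team A n → Team A m
  reindex ρ X t = Σ (Vec A _) λ s → X s × (t ≡ tabulate (λ i → lookup s (ρ i)))

record TeamMap {σ : Signature} {ℓ : Level} (𝔄 𝔅 : Structure σ ℓ) : Set (lsuc ℓ) where
  field
    fmap : ∀ {n} → Team (Carrier 𝔄) n → Team (Carrier 𝔅) n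
    -- f is a function on relations (sets), so respects extensional equality
    fcong : ∀ {n} {X Y : Team (Carrier 𝔄) n} → X ≐ Y → fmap X ≐ fmap Y

  InRange : ∀ {n} → Team (Carrier 𝔅) n → Set (lsuc ℓ)
  InRange P = Σ (Team (Carrier 𝔄) _) λ X → fmap X ≐ P

  field
    rng-empty : ∀ n → InRange (emptyRel n)
    rng-full  : ∀ n → InRange (fullRel n)
    rng-diag  : InRange diagRel
    rng-rel   : ∀ R → InRange (relI 𝔅 R)
    rng-fun   : ∀ f → InRange {suc (funAr σ f)} (λ t → head t ≡ funI 𝔅 f (tail t))
    rng-∩     : ∀ {n} {P Q : Team (Carrier 𝔅) n} → InRange P → InRange Q → InRange (P ∩ Q)
    rng-×     : ∀ {n m} {P : Team (Carrier 𝔅) n} {Q : Team (Carrier 𝔅) m} →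
                InRange P → InRange Q → InRange (P ×ᴿ Q)
    rng-reindex : ∀ {n m} (ρ : Fin m → Fin n) → Injective _≡_ _≡_ ρ →
                  {P : Team (Carrier 𝔅) n} → InRange P → InRange (reindex ρ P)
open TeamMap public

record ElementaryTeamEmbedding {σ : Signature} {ℓ : Level} (𝔄 𝔅 : Structure σ ℓ) : Set (lsuc ℓ) where
  field
    teamMap : TeamMap 𝔄 𝔅
  field
    pres-× : ∀ {n m} (X : Team (Carrier 𝔄) n) (Y : Team (Carrier 𝔄) m) →
             fmap teamMap (X ×ᴿ Y) ≐ (fmap teamMap X ×ᴿ fmap teamMap Y)
    elementary : ∀ {n} (φ : FOT σ n) (X : Team (Carrier 𝔄) n) →
                 (SatFOT 𝔄 X φ → SatFOT 𝔅 (fmap teamMap X) φ) × (SatFOT 𝔅 (fmap teamMap X) φ → SatFOT 𝔄 X φ)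
open ElementaryTeamEmbedding public

IsIndependenceTeamEmbedding : ∀ {σ ℓ} {𝔄 𝔅 : Structure σ ℓ} → TeamMap 𝔄 𝔅 → Set (lsuc ℓ)
IsIndependenceTeamEmbedding {σ} {ℓ} {𝔄} {𝔅} f =
  ∀ {n} (φ : FOIL σ n) (X : Team (Carrier 𝔄) n) → SatFOIL 𝔄 X φ → SatFOIL 𝔅 (fmap f X) φ

{-# OPTIONS --safe #-}
-- Each clause of FOIL's team semantics is a relation between teams (X = Y ∪ Z; X is the
-- projection of X(F/x) forgetting x; X(A/x) = A × X) or, for x⃗ ⊥_z⃗ y⃗, a property of a
-- single team, and each can be expressed by an FOT formula evaluated on the product of the
-- teams involved, provided they are nonempty. Projections of a product are compared by
-- inclusion atoms, and fixing a tuple a⃗ with ∀¹ turns an inclusion atom into the membership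
-- test a⃗ ∈ X[x⃗], so first-order statements about projections become FOT formulas. Since f
-- commutes with products and preserves and reflects FOT (in particular emptiness, via ~), the
-- images of the teams satisfy the same relations, and induction on the formula finishes.
-- Excluded middle decides emptiness and makes ~φ ⊔ ψ an implication.
module Submission where

open import Defs
open import Level using (Level; Lift; lift; lower) renaming (suc to lsuc)
open import Axiom.ExcludedMiddle using (ExcludedMiddle)
open import Data.Nat using (zero; suc; _+_)
open import Data.Fin using (Fin; suc; _↑ˡ_; _↑ʳ_)
open import Data.Vec using (Vec; _∷_; []; lookup; take; drop; map; _++_; allFin)
open import Data.Vec.Properties
  using (map-++; map-∘; map-cong; lookup-++ˡ; lookup-++ʳ; ++-injective; map-lookup-allFin; take++drop≡id)
open import Data.Product using (_×_; _,_; ∃; proj₁; proj₂)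
open import Data.Sum using (inj₁; inj₂; [_,_]; swap) renaming (map to ⊎-map)
open import Data.Empty using (⊥-elim)
open import Function using (_∘_)
open import Data.Unit using (tt)
open import Relation.Nullary using (Dec; yes; no)
open import Relation.Nullary.Decidable using (map′)
open import Relation.Unary using (_⊆_; _≐_; _∪_; Empty; Satisfiable)
open import Relation.Unary.Properties using (≐-refl; ≐-sym; ≐-trans)
open import Relation.Binary.PropositionalEquality using (_≡_; refl; sym; trans; cong₂; subst)

tailCoords : ∀ n → Vec (Fin (suc n)) n
tailCoords n = map suc (allFin n)

block₁ : ∀ a b c → Vec (Fin (a + (b + c))) a
block₁ a b c = map (_↑ˡ (b + c)) (allFin a)

block₂ : ∀ a b c → Vec (Fin (a + (b + c))) b
block₂ a b c = map (a ↑ʳ_) (map (_↑ˡ c) (allFin b))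

block₃ : ∀ a b c → Vec (Fin (a + (b + c))) c
block₃ a b c = map (a ↑ʳ_) (map (b ↑ʳ_) (allFin c))

module _ {ℓ : Level} {A : Set ℓ} where

  select-↑ˡ : ∀ {m n k} (u : Vec A m) (v : Vec A n) (is : Vec (Fin m) k) →
              (u ++ v) [ map (_↑ˡ n) is ] ≡ u [ is ]
  select-↑ˡ {n = n} u v is =
    trans (sym (map-∘ (lookup (u ++ v)) (_↑ˡ n) is)) (map-cong (lookup-++ˡ u v) is)

  select-↑ʳ : ∀ {m n k} (u : Vec A m) (v : Vec A n) (is : Vec (Fin n) k) →
              (u ++ v) [ map (m ↑ʳ_) is ] ≡ v [ is ]
  select-↑ʳ {m = m} u v is =
    trans (sym (map-∘ (lookup (u ++ v)) (m ↑ʳ_) is)) (map-cong (lookup-++ʳ u v) is)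

  select-allFin : ∀ {n} (u : Vec A n) → u [ allFin n ] ≡ u
  select-allFin = map-lookup-allFin

  select-++ : ∀ {n k j} (u : Vec A n) (is : Vec (Fin n) k) (js : Vec (Fin n) j) →
              u [ is ++ js ] ≡ u [ is ] ++ u [ js ]
  select-++ u = map-++ (lookup u)

  select-++-injective : ∀ {n m k j} (s : Vec A n) (u : Vec A m)
                        (xs : Vec (Fin n) k) (ys : Vec (Fin n) j)
                        (ps : Vec (Fin m) k) (qs : Vec (Fin m) j) →
                        s [ xs ++ ys ] ≡ u [ ps ++ qs ] → s [ xs ] ≡ u [ ps ] × s [ ys ] ≡ u [ qs ]
  select-++-injective s u xs ys ps qs e =
    ++-injective (s [ xs ]) (u [ ps ]) (trans (sym (select-++ s xs ys)) (trans e (select-++ u ps qs)))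

  select-++-cong : ∀ {n m k j} (s : Vec A n) (u : Vec A m)
                   (xs : Vec (Fin n) k) (ys : Vec (Fin n) j)
                   (ps : Vec (Fin m) k) (qs : Vec (Fin m) j) →
                   s [ xs ] ≡ u [ ps ] → s [ ys ] ≡ u [ qs ] → s [ xs ++ ys ] ≡ u [ ps ++ qs ]
  select-++-cong s u xs ys ps qs e e' =
    trans (select-++ s xs ys) (trans (cong₂ _++_ e e') (sym (select-++ u ps qs)))

  take-drop-++ : ∀ {m n} (u : Vec A m) (v : Vec A n) → take m (u ++ v) ≡ u × drop m (u ++ v) ≡ v
  take-drop-++ {m} u v = ++-injective _ u (take++drop≡id m (u ++ v))

  select-tailCoords : ∀ {n} (x : A) (u : Vec A n) → (x ∷ u) [ tailCoords n ] ≡ u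
  select-tailCoords x u = trans (sym (map-∘ (lookup (x ∷ u)) suc (allFin _))) (select-allFin u)

  module _ {a b c} (u : Vec A a) (v : Vec A b) (w : Vec A c) where

    select-block₁ : (u ++ (v ++ w)) [ block₁ a b c ] ≡ u
    select-block₁ = trans (select-↑ˡ u (v ++ w) (allFin a)) (select-allFin u)

    select-block₂ : (u ++ (v ++ w)) [ block₂ a b c ] ≡ v
    select-block₂ = trans (select-↑ʳ u (v ++ w) _) (trans (select-↑ˡ v w (allFin b)) (select-allFin v))

    select-block₃ : (u ++ (v ++ w)) [ block₃ a b c ] ≡ w
    select-block₃ = trans (select-↑ʳ u (v ++ w) _) (trans (select-↑ʳ v w (allFin c)) (select-allFin w))

  infixl 9 _↾_

  _↾_ : ∀ {n k} → Team A n → Vec (Fin n) k → Team A k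
  (X ↾ xs) u = ∃ λ s → X s × s [ xs ] ≡ u

  ↾-allFin : ∀ {n} {X : Team A n} → X ↾ allFin n ≐ X
  ↾-allFin {X = X} = (λ { (s , Xs , refl) → subst X (sym (select-allFin s)) Xs })
                   , (λ {s} Xs → s , Xs , select-allFin s)

  ↾-empty : ∀ {n k} {X : Team A n} (xs : Vec (Fin n) k) → Empty X → Empty (X ↾ xs)
  ↾-empty xs empty _ (s , Xs , _) = empty s Xs

  ↾-≐-satisfiable : ∀ {m n k} {P : Team A m} {Q : Team A n} {ps : Vec (Fin m) k} {qs : Vec (Fin n) k} →
                    P ↾ ps ≐ Q ↾ qs → Satisfiable P → Satisfiable Q
  ↾-≐-satisfiable (P⊆Q , _) (s , Ps) = let s' , Qs' , _ = P⊆Q (s , Ps , refl) in s' , Qs'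

  empty-≐ : ∀ {n} {X Y : Team A n} → Empty X → Empty Y → X ≐ Y
  empty-≐ emptyX emptyY = (λ {s} Xs → ⊥-elim (emptyX s Xs)) , (λ {s} Ys → ⊥-elim (emptyY s Ys))

  supp1-≐ : ∀ {n} {X Y : Team A n} {a} → X ≐ Y → supp1 X a ≐ supp1 Y a
  supp1-≐ (X⊆Y , Y⊆X) = (λ (e , Xt) → e , X⊆Y Xt) , (λ (e , Yt) → e , Y⊆X Yt)

  supplement-≐ : ∀ {n} {X Y : Team A n} {G} → X ≐ Y → supplement X G ≐ supplement Y G
  supplement-≐ (X⊆Y , Y⊆X) = (λ (Xt , Gt) → X⊆Y Xt , Gt) , (λ (Yt , Gt) → Y⊆X Yt , Gt)

  duplicate-≐ : ∀ {n} {X Y : Team A n} → X ≐ Y → duplicate X ≐ duplicate Y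
  duplicate-≐ (X⊆Y , Y⊆X) = X⊆Y , Y⊆X

  ∪-cong : ∀ {n} {Y Y' Z Z' : Team A n} → Y ≐ Y' → Z ≐ Z' → Y ∪ Z ≐ Y' ∪ Z'
  ∪-cong (Y⊆ , ⊇Y) (Z⊆ , ⊇Z) = [ inj₁ ∘ Y⊆ , inj₂ ∘ Z⊆ ] , [ inj₁ ∘ ⊇Y , inj₂ ∘ ⊇Z ]

  ∪-comm : ∀ {n} {Y Z : Team A n} → Y ∪ Z ≐ Z ∪ Y
  ∪-comm = swap , swap

  ∪-emptyˡ : ∀ {n} {Y Z : Team A n} → Empty Y → Y ∪ Z ≐ Z
  ∪-emptyˡ empty = (λ {s} → [ (λ Ys → ⊥-elim (empty s Ys)) , (λ Zs → Zs) ]) , inj₂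

  ×ᴿ-intro : ∀ {m n} {P : Team A m} {Q : Team A n} {u v} → P u → Q v → (P ×ᴿ Q) (u ++ v)
  ×ᴿ-intro {P = P} {Q} {u} {v} Pu Qv =
    subst P (sym (proj₁ (take-drop-++ u v))) Pu , subst Q (sym (proj₂ (take-drop-++ u v))) Qv

  ×ᴿ-satisfiable : ∀ {m n} {P : Team A m} {Q : Team A n} →
                   Satisfiable P → Satisfiable Q → Satisfiable (P ×ᴿ Q)
  ×ᴿ-satisfiable {P = P} {Q} (u , Pu) (v , Qv) = u ++ v , ×ᴿ-intro {P = P} {Q} Pu Qv

  ×ᴿ-cong : ∀ {m n} {P P' : Team A m} {Q Q' : Team A n} → P ≐ P' → Q ≐ Q' → P ×ᴿ Q ≐ P' ×ᴿ Q'
  ×ᴿ-cong (P⊆ , ⊇P) (Q⊆ , ⊇Q) = (λ (Pt , Qt) → P⊆ Pt , Q⊆ Qt) , (λ (Pt , Qt) → ⊇P Pt , ⊇Q Qt)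

  ↾-×ᴿ-↑ˡ : ∀ {m n k} {P : Team A m} {Q : Team A n} (is : Vec (Fin m) k) →
            Satisfiable Q → (P ×ᴿ Q) ↾ map (_↑ˡ n) is ≐ P ↾ is
  ↾-×ᴿ-↑ˡ {m} {P = P} {Q} is (v , Qv) =
    (λ { (t , (Pt , _) , refl) → take m t , Pt , sym (select-take t) })
    , (λ { (u , Pu , refl) → u ++ v , ×ᴿ-intro {P = P} {Q} Pu Qv , select-↑ˡ u v is })
    where
    select-take : ∀ t → t [ map (_↑ˡ _) is ] ≡ take m t [ is ]
    select-take t = subst (λ t' → t' [ map (_↑ˡ _) is ] ≡ take m t [ is ])
                          (take++drop≡id m t) (select-↑ˡ (take m t) (drop m t) is)

  ↾-×ᴿ-↑ʳ : ∀ {m n k} {P : Team A m} {Q : Team A n} (is : Vec (Fin n) k) →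
            Satisfiable P → (P ×ᴿ Q) ↾ map (m ↑ʳ_) is ≐ Q ↾ is
  ↾-×ᴿ-↑ʳ {m} {P = P} {Q} is (u , Pu) =
    (λ { (t , (_ , Qt) , refl) → drop m t , Qt , sym (select-drop t) })
    , (λ { (v , Qv , refl) → u ++ v , ×ᴿ-intro {P = P} {Q} Pu Qv , select-↑ʳ u v is })
    where
    select-drop : ∀ t → t [ map (m ↑ʳ_) is ] ≡ drop m t [ is ]
    select-drop t = subst (λ t' → t' [ map (m ↑ʳ_) is ] ≡ drop m t [ is ])
                          (take++drop≡id m t) (select-↑ʳ (take m t) (drop m t) is)

  duplicate-≐-×ᴿ : ∀ {n} {X : Team A n} → duplicate X ≐ fullRel 1 ×ᴿ X
  duplicate-≐-×ᴿ = (λ { {_ ∷ _} Xs → lift tt , Xs }) , (λ { {_ ∷ _} (_ , Xs) → Xs })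

  module _ {a b c} {P : Team A a} {Q : Team A b} {R : Team A c} where

    ↾-×ᴿ-block₁ : Satisfiable Q → Satisfiable R → (P ×ᴿ (Q ×ᴿ R)) ↾ block₁ a b c ≐ P
    ↾-×ᴿ-block₁ satQ satR =
      ≐-trans (↾-×ᴿ-↑ˡ {P = P} (allFin a) (×ᴿ-satisfiable {P = Q} {R} satQ satR)) ↾-allFin

    ↾-×ᴿ-block₂ : Satisfiable P → Satisfiable R → (P ×ᴿ (Q ×ᴿ R)) ↾ block₂ a b c ≐ Q
    ↾-×ᴿ-block₂ satP satR =
      ≐-trans (↾-×ᴿ-↑ʳ {P = P} (map (_↑ˡ c) (allFin b)) satP)
              (≐-trans (↾-×ᴿ-↑ˡ {P = Q} (allFin b) satR) ↾-allFin)

    ↾-×ᴿ-block₃ : Satisfiable P → Satisfiable Q → (P ×ᴿ (Q ×ᴿ R)) ↾ block₃ a b c ≐ R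
    ↾-×ᴿ-block₃ satP satQ =
      ≐-trans (↾-×ᴿ-↑ʳ {P = P} (map (b ↑ʳ_) (allFin c)) satP)
              (≐-trans (↾-×ᴿ-↑ʳ {P = Q} (allFin c) satQ) ↾-allFin)

  supplement-↾-tailCoords : ∀ {n} {X : Team A n} {G : Vec A n → A → Set ℓ} →
                            NonEmptyOn X G → supplement X G ↾ tailCoords n ≐ X
  supplement-↾-tailCoords {X = X} nonEmpty =
    (λ { (b ∷ s , (Xs , _) , refl) → subst X (sym (select-tailCoords b s)) Xs })
    , (λ {s} Xs → let b , Gsb = nonEmpty s Xs in b ∷ s , (Xs , Gsb) , select-tailCoords b s)

  ↾-tailCoords-supplement : ∀ {n} {X : Team A n} {X' : Team A (suc n)} → X' ↾ tailCoords n ≐ X →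
                            let G s b = X' (b ∷ s) in NonEmptyOn X G × X' ≐ supplement X G
  ↾-tailCoords-supplement {X' = X'} (⊆X , X⊆) =
      (λ s Xs → witness (X⊆ Xs))
    , (λ { {b ∷ s} X'bs → ⊆X (b ∷ s , X'bs , select-tailCoords b s) , X'bs })
    , (λ { {_ ∷ _} (_ , X'bs) → X'bs })
    where
    witness : ∀ {s} → (X' ↾ tailCoords _) s → ∃ λ b → X' (b ∷ s)
    witness (b ∷ u , X'bu , refl) = b , subst (λ u' → X' (b ∷ u')) (sym (select-tailCoords b u)) X'bu

  -- suppN a⃗ X = X(a⃗/v⃗) for fresh variables v⃗, which occupy the first k positions.
  suppN : ∀ {k n} → Vec A k → Team A n → Team A (k + n)
  suppN []       X = X
  suppN (a ∷ as) X = supp1 (suppN as X) a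

  suppN-intro : ∀ {k n} (as : Vec A k) {X : Team A n} {s} → X s → suppN as X (as ++ s)
  suppN-intro []       Xs = Xs
  suppN-intro (a ∷ as) Xs = refl , suppN-intro as Xs

  suppN-elim : ∀ {k n} (as : Vec A k) {X : Team A n} {t} → suppN as X t → ∃ λ s → X s × t ≡ as ++ s
  suppN-elim []       {t = t} Xt = t , Xt , refl
  suppN-elim (a ∷ as) {t = b ∷ t} (b≡a , Xt) =
    let s , Xs , t≡ = suppN-elim as Xt in s , Xs , cong₂ _∷_ b≡a t≡

  suppN-satisfiable : ∀ {k n} {X : Team A n} (as : Vec A k) → Satisfiable X → Satisfiable (suppN as X)
  suppN-satisfiable as (s , Xs) = as ++ s , suppN-intro as Xs

  suppN-satisfiable⁻ : ∀ {k n} {X : Team A n} (as : Vec A k) → Satisfiable (suppN as X) → Satisfiable X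
  suppN-satisfiable⁻ as (t , St) = let s , Xs , _ = suppN-elim as St in s , Xs

module _ {σ : Signature} where

  trueF : ∀ {n} → FOT σ n
  trueF = incl [] []

  emptyF : ∀ {n} → FOT σ n
  emptyF = ~ trueF

  domainNonEmptyF : ∀ {n} → FOT σ n
  domainNonEmptyF = ex1 trueF

  -- As ~ is weak negation, φ ⇒ ψ holds on the empty team; on other teams it is implication.
  infixr 5 _⇒_

  _⇒_ : ∀ {n} → FOT σ n → FOT σ n → FOT σ n
  φ ⇒ ψ = (~ φ) ⊔ ψ

  allN : ∀ k {n} → FOT σ (k + n) → FOT σ n
  allN zero    φ = φ
  allN (suc k) φ = allN k (all1 φ)

  -- On suppN a⃗ X with X nonempty, this atom says that a⃗[ps] ∈ X[xs].
  memberF : ∀ {k n j} → Vec (Fin k) j → Vec (Fin n) j → FOT σ (k + n)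
  memberF {k} {n} ps xs = incl (map (_↑ˡ n) ps) (map (k ↑ʳ_) xs)

  sameProjectionF : ∀ {n k} → Vec (Fin n) k → Vec (Fin n) k → FOT σ n
  sameProjectionF xs ys = incl xs ys ∧ incl ys xs

  unionF : ∀ {m n} → Vec (Fin m) n → Vec (Fin m) n → Vec (Fin m) n → FOT σ m
  unionF {n = n} xs ys zs =
    (incl ys xs ∧ incl zs xs)
    ∧ allN n (memberF (allFin n) xs ⇒ (memberF (allFin n) ys ⊔ memberF (allFin n) zs))

  fullF : ∀ n → FOT σ n
  fullF n = allN n (memberF (allFin n) (allFin n))

  -- ∀a⃗b⃗c⃗. a⃗c⃗ ∈ X[x⃗z⃗] → b⃗c⃗ ∈ X[y⃗z⃗] → a⃗b⃗c⃗ ∈ X[x⃗y⃗z⃗], where a⃗, b⃗, c⃗ are the blocks A, B, C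
  -- of the fixed tuple.
  independenceF : ∀ {n a b c} → Vec (Fin n) a → Vec (Fin n) c → Vec (Fin n) b → FOT σ n
  independenceF {a = a} {b} {c} xs zs ys =
    allN (a + (b + c))
      (memberF (A ++ C) (xs ++ zs) ⇒ memberF (B ++ C) (ys ++ zs) ⇒
       memberF (A ++ (B ++ C)) (xs ++ (ys ++ zs)))
    where
    A = block₁ a b c
    B = block₂ a b c
    C = block₃ a b c

Independent : ∀ {ℓ} {A : Set ℓ} {n a b c} → Vec (Fin n) a → Vec (Fin n) c → Vec (Fin n) b → Team A n → Set ℓ
Independent xs zs ys X =
  ∀ s s' → X s → X s' → s [ zs ] ≡ s' [ zs ] →
  ∃ λ s'' → X s'' × (s'' [ xs ] ≡ s [ xs ]) × (s'' [ zs ] ≡ s [ zs ]) × (s'' [ ys ] ≡ s' [ ys ])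

satisfiable? : ∀ {ℓ} {A : Set ℓ} {n} → ExcludedMiddle (lsuc ℓ) → (X : Team A n) → Dec (Satisfiable X)
satisfiable? {ℓ} em X = map′ lower lift (em {Lift (lsuc ℓ) (Satisfiable X)})

module Semantics {σ : Signature} {ℓ : Level} (𝔐 : Structure σ ℓ) where
  private
    M = Carrier 𝔐
    Sat : ∀ {n} → Team M n → FOT σ n → Set (lsuc ℓ)
    Sat = SatFOT 𝔐

  satFOT-≐ : ∀ {n} {X Y : Team M n} (φ : FOT σ n) → X ≐ Y → Sat X φ → Sat Y φ
  satFOT-≐ (lit α)      (_ , Y⊆X) (lift h) = lift λ s Ys → h s (Y⊆X Ys)
  satFOT-≐ (incl xs ys) (X⊆Y , Y⊆X) (lift h) =
    lift λ s Ys → let s' , Xs' , e = h s (Y⊆X Ys) in s' , X⊆Y Xs' , e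
  satFOT-≐ (const xs)   (_ , Y⊆X) (lift h) = lift λ s s' Ys Ys' → h s s' (Y⊆X Ys) (Y⊆X Ys')
  satFOT-≐ (~ φ)        (_ , Y⊆X) (inj₁ (lift empty)) = inj₁ (lift λ s Ys → empty s (Y⊆X Ys))
  satFOT-≐ (~ φ)        X≐Y (inj₂ ¬φ) = inj₂ λ φY → ¬φ (satFOT-≐ φ (≐-sym X≐Y) φY)
  satFOT-≐ (φ ∧ ψ)      X≐Y (φX , ψX) = satFOT-≐ φ X≐Y φX , satFOT-≐ ψ X≐Y ψX
  satFOT-≐ (φ ⊔ ψ)      X≐Y (inj₁ φX) = inj₁ (satFOT-≐ φ X≐Y φX)
  satFOT-≐ (φ ⊔ ψ)      X≐Y (inj₂ ψX) = inj₂ (satFOT-≐ ψ X≐Y ψX)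
  satFOT-≐ (ex1 φ)      X≐Y (a , φX) = a , satFOT-≐ φ (supp1-≐ X≐Y) φX
  satFOT-≐ (all1 φ)     X≐Y φX = λ a → satFOT-≐ φ (supp1-≐ X≐Y) (φX a)

  satFOIL-≐ : ∀ {n} {X Y : Team M n} (φ : FOIL σ n) → X ≐ Y → SatFOIL 𝔐 X φ → SatFOIL 𝔐 Y φ
  satFOIL-≐ (lit α)           (_ , Y⊆X) (lift h) = lift λ s Ys → h s (Y⊆X Ys)
  satFOIL-≐ (indep xs zs ys)  (X⊆Y , Y⊆X) (lift h) =
    lift λ s s' Ys Ys' e → let s'' , Xs'' , rest = h s s' (Y⊆X Ys) (Y⊆X Ys') e in s'' , X⊆Y Xs'' , rest
  satFOIL-≐ (φ ∧ ψ)           X≐Y (φX , ψX) = satFOIL-≐ φ X≐Y φX , satFOIL-≐ ψ X≐Y ψX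
  satFOIL-≐ (φ ∨ ψ)           (X⊆Y , Y⊆X) (Z , Z' , cover , φZ , ψZ') =
    Z , Z' , (λ s → proj₁ (cover s) ∘ Y⊆X , X⊆Y ∘ proj₂ (cover s)) , φZ , ψZ'
  satFOIL-≐ (ex φ)            X≐Y (G , nonEmpty , φXG) =
    G , (λ s Ys → nonEmpty s (proj₂ X≐Y Ys)) , satFOIL-≐ φ (supplement-≐ {G = G} X≐Y) φXG
  satFOIL-≐ (all φ)           X≐Y φX = satFOIL-≐ φ (duplicate-≐ X≐Y) φX

  trueF-sat : ∀ {n} {X : Team M n} → Sat X trueF
  trueF-sat = lift λ s Xs → s , Xs , refl

  emptyF⇒Empty : ∀ {n} {X : Team M n} → Sat X emptyF → Empty X
  emptyF⇒Empty (inj₁ (lift empty)) = empty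
  emptyF⇒Empty (inj₂ ¬true)        = ⊥-elim (¬true trueF-sat)

  incl⇒⊆ : ∀ {n k} {X : Team M n} {xs ys : Vec (Fin n) k} → Sat X (incl xs ys) → X ↾ xs ⊆ X ↾ ys
  incl⇒⊆ (lift h) (s , Xs , refl) = h s Xs

  ⊆⇒incl : ∀ {n k} {X : Team M n} {xs ys : Vec (Fin n) k} → X ↾ xs ⊆ X ↾ ys → Sat X (incl xs ys)
  ⊆⇒incl ⊆ = lift λ s Xs → ⊆ (s , Xs , refl)

  sameProjectionF⇒≐ : ∀ {n k} {X : Team M n} {xs ys : Vec (Fin n) k} →
                      Sat X (sameProjectionF xs ys) → X ↾ xs ≐ X ↾ ys
  sameProjectionF⇒≐ (xs⊆ys , ys⊆xs) = incl⇒⊆ xs⊆ys , incl⇒⊆ ys⊆xs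

  ≐⇒sameProjectionF : ∀ {n k} {X : Team M n} {xs ys : Vec (Fin n) k} →
                      X ↾ xs ≐ X ↾ ys → Sat X (sameProjectionF xs ys)
  ≐⇒sameProjectionF (xs⊆ys , ys⊆xs) = ⊆⇒incl xs⊆ys , ⊆⇒incl ys⊆xs

  allN-intro : ∀ k {n} {X : Team M n} (φ : FOT σ (k + n)) → (∀ as → Sat (suppN as X) φ) → Sat X (allN k φ)
  allN-intro zero    φ h = h []
  allN-intro (suc k) φ h = allN-intro k (all1 φ) λ as a → h (a ∷ as)

  allN-elim : ∀ k {n} {X : Team M n} (φ : FOT σ (k + n)) → Sat X (allN k φ) → ∀ as → Sat (suppN as X) φ
  allN-elim zero    φ h []       = h
  allN-elim (suc k) φ h (a ∷ as) = allN-elim k (all1 φ) h as a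

  ⇒-elim : ∀ {n} {X : Team M n} {φ ψ : FOT σ n} → Satisfiable X → Sat X (φ ⇒ ψ) → Sat X φ → Sat X ψ
  ⇒-elim (s , Xs) (inj₁ (inj₁ (lift empty))) _  = ⊥-elim (empty s Xs)
  ⇒-elim _        (inj₁ (inj₂ ¬φ))           φX = ⊥-elim (¬φ φX)
  ⇒-elim _        (inj₂ ψX)                  _  = ψX

  member⇒↾ : ∀ {k n j} {X : Team M n} (as : Vec M k) (ps : Vec (Fin k) j) (xs : Vec (Fin n) j) →
             Satisfiable X → Sat (suppN as X) (memberF ps xs) → (X ↾ xs) (as [ ps ])
  member⇒↾ as ps xs (s , Xs) (lift h) with h (as ++ s) (suppN-intro as Xs)
  ... | t , St , e with suppN-elim as St
  ...   | s' , Xs' , refl = s' , Xs' , trans (sym (select-↑ʳ as s' xs)) (trans e (select-↑ˡ as s ps))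

  ↾⇒member : ∀ {k n j} {X : Team M n} (as : Vec M k) (ps : Vec (Fin k) j) (xs : Vec (Fin n) j) →
             (X ↾ xs) (as [ ps ]) → Sat (suppN as X) (memberF ps xs)
  ↾⇒member {X = X} as ps xs (s , Xs , e) = lift witness
    where
    witness : ∀ t → suppN as X t →
              ∃ λ t' → suppN as X t' × t' [ map (_ ↑ʳ_) xs ] ≡ t [ map (_↑ˡ _) ps ]
    witness t St with suppN-elim as St
    ... | s₀ , _ , refl =
      as ++ s , suppN-intro as Xs , trans (select-↑ʳ as s xs) (trans e (sym (select-↑ˡ as s₀ ps)))

  member-allFin⇒↾ : ∀ {k n} {X : Team M n} (as : Vec M k) (xs : Vec (Fin n) k) →
                    Satisfiable X → Sat (suppN as X) (memberF (allFin k) xs) → (X ↾ xs) as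
  member-allFin⇒↾ {X = X} as xs satX =
    subst (X ↾ xs) (select-allFin as) ∘ member⇒↾ as (allFin _) xs satX

  ↾⇒member-allFin : ∀ {k n} {X : Team M n} (as : Vec M k) (xs : Vec (Fin n) k) →
                    (X ↾ xs) as → Sat (suppN as X) (memberF (allFin k) xs)
  ↾⇒member-allFin {X = X} as xs =
    ↾⇒member as (allFin _) xs ∘ subst (X ↾ xs) (sym (select-allFin as))

  fullF⇒full : ∀ {n} {X : Team M n} → Satisfiable X → Sat X (fullF n) → ∀ as → X as
  fullF⇒full {n} satX h as = proj₁ ↾-allFin (member-allFin⇒↾ as (allFin n) satX (allN-elim n _ h as))

  fullRel-fullF : ∀ {n} → Sat (fullRel n) (fullF n)
  fullRel-fullF {n} = allN-intro n _ λ as → ↾⇒member-allFin as (allFin n) (as , lift tt , select-allFin as)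

  unionF⇒≐∪ : ∀ {m n} {T : Team M m} {xs ys zs : Vec (Fin m) n} →
              Sat T (unionF xs ys zs) → T ↾ xs ≐ T ↾ ys ∪ T ↾ zs
  unionF⇒≐∪ {m} {n} {T} {xs} {ys} {zs} ((ys⊆xs , zs⊆xs) , h) =
    ⊆∪ , [ incl⇒⊆ ys⊆xs , incl⇒⊆ zs⊆xs ]
    where
    member : Vec (Fin m) n → FOT σ (n + m)
    member = memberF (allFin n)
    ⊆∪ : T ↾ xs ⊆ T ↾ ys ∪ T ↾ zs
    ⊆∪ {as} x@(s , Ts , _) =
      ⊎-map (member-allFin⇒↾ as ys (s , Ts)) (member-allFin⇒↾ as zs (s , Ts))
        (⇒-elim {φ = member xs} {ψ = member ys ⊔ member zs} (suppN-satisfiable as (s , Ts))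
                (allN-elim n _ h as) (↾⇒member-allFin as xs x))

  independenceF⇒Independent : ∀ {n a b c} {X : Team M n}
                              (xs : Vec (Fin n) a) (zs : Vec (Fin n) c) (ys : Vec (Fin n) b) →
                              Sat X (independenceF xs zs ys) → Independent xs zs ys X
  independenceF⇒Independent {a = a} {b} {c} {X} xs zs ys h s s' Xs Xs' s≡s' =
    conclude (member⇒↾ as (A ++ (B ++ C)) (xs ++ (ys ++ zs)) (s , Xs)
               (⇒-elim {φ = memberF (B ++ C) (ys ++ zs)} {ψ = ABC} satS
                 (⇒-elim {φ = memberF (A ++ C) (xs ++ zs)} {ψ = memberF (B ++ C) (ys ++ zs) ⇒ ABC} satS
                   (allN-elim (a + (b + c)) _ h as) m₁) m₂))
    where
    A = block₁ a b c
    B = block₂ a b c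
    C = block₃ a b c
    ABC = memberF (A ++ (B ++ C)) (xs ++ (ys ++ zs))
    as = s [ xs ] ++ (s' [ ys ] ++ s [ zs ])
    select-A = select-block₁ (s [ xs ]) (s' [ ys ]) (s [ zs ])
    select-B = select-block₂ (s [ xs ]) (s' [ ys ]) (s [ zs ])
    select-C = select-block₃ (s [ xs ]) (s' [ ys ]) (s [ zs ])
    satS = suppN-satisfiable as (s , Xs)
    m₁ = ↾⇒member as (A ++ C) (xs ++ zs)
           (s , Xs , select-++-cong s as xs zs A C (sym select-A) (sym select-C))
    m₂ = ↾⇒member as (B ++ C) (ys ++ zs)
           (s' , Xs' , select-++-cong s' as ys zs B C (sym select-B) (trans (sym s≡s') (sym select-C)))
    conclude : (X ↾ (xs ++ (ys ++ zs))) (as [ A ++ (B ++ C) ]) →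
               ∃ λ s'' → X s'' × (s'' [ xs ] ≡ s [ xs ]) × (s'' [ zs ] ≡ s [ zs ]) × (s'' [ ys ] ≡ s' [ ys ])
    conclude (s'' , Xs'' , e) =
      let x≡ , yz≡ = select-++-injective s'' as xs (ys ++ zs) A (B ++ C) e
          y≡ , z≡  = select-++-injective s'' as ys zs B C yz≡
      in s'' , Xs'' , trans x≡ select-A , trans z≡ select-C , trans y≡ select-B

  module Classical (em : ExcludedMiddle (lsuc ℓ)) where

    ⇒-intro : ∀ {n} {X : Team M n} {φ ψ : FOT σ n} → (Satisfiable X → Sat X φ → Sat X ψ) → Sat X (φ ⇒ ψ)
    ⇒-intro {X = X} {φ} h with em {Sat X φ} | satisfiable? em X
    ... | no ¬φX | _         = inj₁ (inj₂ ¬φX)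
    ... | yes φX | yes satX  = inj₂ (h satX φX)
    ... | yes _  | no ¬satX  = inj₁ (inj₁ (lift λ s Xs → ¬satX (s , Xs)))

    ≐∪⇒unionF : ∀ {m n} {T : Team M m} {xs ys zs : Vec (Fin m) n} →
                T ↾ xs ≐ T ↾ ys ∪ T ↾ zs → Sat T (unionF xs ys zs)
    ≐∪⇒unionF {m} {n} {T} {xs} {ys} {zs} (⊆∪ , ∪⊆) =
      (⊆⇒incl (∪⊆ ∘ inj₁) , ⊆⇒incl (∪⊆ ∘ inj₂))
      , allN-intro n _ λ as → ⇒-intro {φ = member xs} {ψ = member ys ⊔ member zs} (body as)
      where
      member : Vec (Fin m) n → FOT σ (n + m)
      member = memberF (allFin n)
      body : ∀ as → Satisfiable (suppN as T) →
             Sat (suppN as T) (member xs) → Sat (suppN as T) (member ys ⊔ member zs)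
      body as satS =
        ⊎-map (↾⇒member-allFin as ys) (↾⇒member-allFin as zs)
        ∘ ⊆∪ ∘ member-allFin⇒↾ as xs (suppN-satisfiable⁻ as satS)

    Independent⇒independenceF : ∀ {n a b c} {X : Team M n}
                                (xs : Vec (Fin n) a) (zs : Vec (Fin n) c) (ys : Vec (Fin n) b) →
                                Independent xs zs ys X → Sat X (independenceF xs zs ys)
    Independent⇒independenceF {a = a} {b} {c} {X} xs zs ys independent =
      allN-intro (a + (b + c)) _ λ as →
        ⇒-intro {φ = memberF (A ++ C) (xs ++ zs)} {ψ = memberF (B ++ C) (ys ++ zs) ⇒ ABC} λ satS m₁ →
        ⇒-intro {φ = memberF (B ++ C) (ys ++ zs)} {ψ = ABC} λ _ m₂ →
        let satX = suppN-satisfiable⁻ as satS in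
        ↾⇒member as (A ++ (B ++ C)) (xs ++ (ys ++ zs))
          (combine as (member⇒↾ as (A ++ C) (xs ++ zs) satX m₁) (member⇒↾ as (B ++ C) (ys ++ zs) satX m₂))
      where
      A = block₁ a b c
      B = block₂ a b c
      C = block₃ a b c
      ABC = memberF (A ++ (B ++ C)) (xs ++ (ys ++ zs))
      combine : ∀ as → (X ↾ (xs ++ zs)) (as [ A ++ C ]) → (X ↾ (ys ++ zs)) (as [ B ++ C ]) →
                (X ↾ (xs ++ (ys ++ zs))) (as [ A ++ (B ++ C) ])
      combine as (s₁ , Xs₁ , e₁) (s₂ , Xs₂ , e₂) =
        let x₁ , z₁ = select-++-injective s₁ as xs zs A C e₁
            y₂ , z₂ = select-++-injective s₂ as ys zs B C e₂
            s'' , Xs'' , x≡ , z≡ , y≡ = independent s₁ s₂ Xs₁ Xs₂ (trans z₁ (sym z₂))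
        in s'' , Xs'' , select-++-cong s'' as xs (ys ++ zs) A (B ++ C) (trans x≡ x₁)
                          (select-++-cong s'' as ys zs B C (trans y≡ y₂) (trans z≡ z₁))

module Transfer {σ : Signature} {ℓ : Level} {𝔄 𝔅 : Structure σ ℓ}
                (em : ExcludedMiddle (lsuc ℓ)) (f : ElementaryTeamEmbedding 𝔄 𝔅) where
  private
    A = Carrier 𝔄
    B = Carrier 𝔅
    F : ∀ {n} → Team A n → Team B n
    F = fmap (teamMap f)
    module 𝔄 = Semantics 𝔄
    module 𝔅 = Semantics 𝔅
    open 𝔄.Classical em using (≐∪⇒unionF; Independent⇒independenceF)

  preserves : ∀ {n} (φ : FOT σ n) {X : Team A n} → SatFOT 𝔄 X φ → SatFOT 𝔅 (F X) φ
  preserves φ {X} = proj₁ (elementary f φ X)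

  reflects : ∀ {n} (φ : FOT σ n) {X : Team A n} → SatFOT 𝔅 (F X) φ → SatFOT 𝔄 X φ
  reflects φ {X} = proj₂ (elementary f φ X)

  preserves-×ᴿ : ∀ {m n} (φ : FOT σ (m + n)) {P : Team A m} {Q : Team A n} →
                 SatFOT 𝔄 (P ×ᴿ Q) φ → SatFOT 𝔅 (F P ×ᴿ F Q) φ
  preserves-×ᴿ φ {P} {Q} = 𝔅.satFOT-≐ φ (pres-× f P Q) ∘ preserves φ

  fmap-empty : ∀ {n} {X : Team A n} → Empty X → Empty (F X)
  fmap-empty empty = 𝔅.emptyF⇒Empty (preserves emptyF (inj₁ (lift empty)))

  fmap-satisfiable : ∀ {n} {X : Team A n} → Satisfiable X → Satisfiable (F X)
  fmap-satisfiable {X = X} (s , Xs) with satisfiable? em (F X)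
  ... | yes satFX = satFX
  ... | no ¬satFX = ⊥-elim (𝔄.emptyF⇒Empty (reflects emptyF (inj₁ (lift λ t FXt → ¬satFX (t , FXt)))) s Xs)

  reflect-element : B → A
  reflect-element b = proj₁ (reflects domainNonEmptyF {emptyRel 0} (b , 𝔅.trueF-sat))

  fmap-fullRel : ∀ {n} → F (fullRel n) ≐ fullRel n
  fmap-fullRel {n} =
    (λ _ → lift tt)
    , λ {bs} _ → 𝔅.fullF⇒full (fmap-satisfiable (map reflect-element bs , lift tt))
                              (preserves (fullF n) 𝔄.fullRel-fullF) bs

  fmap-duplicate : ∀ {n} {X : Team A n} → F (duplicate X) ≐ duplicate (F X)
  fmap-duplicate {X = X} =
    ≐-trans (fcong (teamMap f) (duplicate-≐-×ᴿ {X = X}))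
      (≐-trans (pres-× f (fullRel 1) X)
        (≐-trans (×ᴿ-cong {Q = F X} fmap-fullRel ≐-refl) (≐-sym (duplicate-≐-×ᴿ {X = F X}))))

  fmap-↾-≐ : ∀ {m n k} {P : Team A m} {Q : Team A n} (ps : Vec (Fin m) k) (qs : Vec (Fin n) k) →
             P ↾ ps ≐ Q ↾ qs → F P ↾ ps ≐ F Q ↾ qs
  fmap-↾-≐ {m} {n} {P = P} {Q} ps qs P≐Q with satisfiable? em P
  ... | no ¬satP =
    empty-≐ (↾-empty ps (fmap-empty λ s Ps → ¬satP (s , Ps)))
            (↾-empty qs (fmap-empty λ s Qs → ¬satP (↾-≐-satisfiable (≐-sym P≐Q) (s , Qs))))
  ... | yes satP =
    ≐-trans (≐-sym (↾-×ᴿ-↑ˡ ps satFQ)) (≐-trans (𝔅.sameProjectionF⇒≐ satFT) (↾-×ᴿ-↑ʳ qs satFP))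
    where
    satQ = ↾-≐-satisfiable P≐Q satP
    satFP = fmap-satisfiable satP
    satFQ = fmap-satisfiable satQ
    satFT : SatFOT 𝔅 (F P ×ᴿ F Q) (sameProjectionF (map (_↑ˡ n) ps) (map (m ↑ʳ_) qs))
    satFT = preserves-×ᴿ (sameProjectionF _ _)
              (𝔄.≐⇒sameProjectionF (≐-trans (↾-×ᴿ-↑ˡ ps satQ) (≐-trans P≐Q (≐-sym (↾-×ᴿ-↑ʳ qs satP)))))

  fmap-supplement : ∀ {n} {X : Team A n} {G : Vec A n → A → Set ℓ} → NonEmptyOn X G →
                    let G' s b = F (supplement X G) (b ∷ s) in
                    NonEmptyOn (F X) G' × F (supplement X G) ≐ supplement (F X) G'
  fmap-supplement {n} nonEmpty =
    ↾-tailCoords-supplement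
      (≐-trans (fmap-↾-≐ (tailCoords n) (allFin n)
                 (≐-trans (supplement-↾-tailCoords nonEmpty) (≐-sym ↾-allFin)))
               ↾-allFin)

  fmap-∪-emptyˡ : ∀ {n} {X Y Z : Team A n} → Empty Y → X ≐ Y ∪ Z → F X ≐ F Y ∪ F Z
  fmap-∪-emptyˡ emptyY X≐Y∪Z =
    ≐-trans (fcong (teamMap f) (≐-trans X≐Y∪Z (∪-emptyˡ emptyY))) (≐-sym (∪-emptyˡ (fmap-empty emptyY)))

  fmap-∪-satisfiable : ∀ {n} {X Y Z : Team A n} →
                       Satisfiable Y → Satisfiable Z → X ≐ Y ∪ Z → F X ≐ F Y ∪ F Z
  fmap-∪-satisfiable {n} {X} {Y} {Z} satY@(y , Yy) satZ X≐Y∪Z =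
    ≐-trans (≐-sym (↾-×ᴿ-block₃ satFY satFZ))
      (≐-trans (𝔅.unionF⇒≐∪ satFT) (∪-cong (↾-×ᴿ-block₁ satFZ satFX) (↾-×ᴿ-block₂ satFY satFX)))
    where
    satX = y , proj₂ X≐Y∪Z (inj₁ Yy)
    satFX = fmap-satisfiable satX
    satFY = fmap-satisfiable satY
    satFZ = fmap-satisfiable satZ
    union : FOT σ (n + (n + n))
    union = unionF (block₃ n n n) (block₁ n n n) (block₂ n n n)
    satT : SatFOT 𝔄 (Y ×ᴿ (Z ×ᴿ X)) union
    satT = ≐∪⇒unionF (≐-trans (↾-×ᴿ-block₃ satY satZ)
                       (≐-trans X≐Y∪Z
                         (∪-cong (≐-sym (↾-×ᴿ-block₁ satZ satX)) (≐-sym (↾-×ᴿ-block₂ satY satX)))))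
    satFT : SatFOT 𝔅 (F Y ×ᴿ (F Z ×ᴿ F X)) union
    satFT = 𝔅.satFOT-≐ union (×ᴿ-cong {P = F Y} ≐-refl (pres-× f Z X))
                        (preserves-×ᴿ union {Y} {Z ×ᴿ X} satT)

  fmap-∪ : ∀ {n} {X Y Z : Team A n} → X ≐ Y ∪ Z → F X ≐ F Y ∪ F Z
  fmap-∪ {Y = Y} {Z} X≐Y∪Z with satisfiable? em Y | satisfiable? em Z
  ... | yes satY | yes satZ = fmap-∪-satisfiable satY satZ X≐Y∪Z
  ... | no ¬satY | _        = fmap-∪-emptyˡ (λ s Ys → ¬satY (s , Ys)) X≐Y∪Z
  ... | yes _    | no ¬satZ =
    ≐-trans (fmap-∪-emptyˡ (λ s Zs → ¬satZ (s , Zs)) (≐-trans X≐Y∪Z ∪-comm)) ∪-comm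

  fmap-Independent : ∀ {n a b c} {X : Team A n}
                     (xs : Vec (Fin n) a) (zs : Vec (Fin n) c) (ys : Vec (Fin n) b) →
                     Independent xs zs ys X → Independent xs zs ys (F X)
  fmap-Independent xs zs ys =
    𝔅.independenceF⇒Independent xs zs ys
    ∘ preserves (independenceF xs zs ys)
    ∘ Independent⇒independenceF xs zs ys

  fmap-preserves-FOIL : ∀ {n} (φ : FOIL σ n) (X : Team A n) → SatFOIL 𝔄 X φ → SatFOIL 𝔅 (F X) φ
  fmap-preserves-FOIL (lit α)          X αX             = preserves (lit α) αX
  fmap-preserves-FOIL (indep xs zs ys) X (lift indepX)  = lift (fmap-Independent xs zs ys indepX)
  fmap-preserves-FOIL (φ ∧ ψ)          X (φX , ψX)      =
    fmap-preserves-FOIL φ X φX , fmap-preserves-FOIL ψ X ψX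
  fmap-preserves-FOIL (φ ∨ ψ)          X (Y , Z , cover , φY , ψZ) =
    let FX⊆ , ⊆FX = fmap-∪ ((λ {s} → proj₁ (cover s)) , (λ {s} → proj₂ (cover s))) in
    F Y , F Z , (λ s → FX⊆ , ⊆FX) , fmap-preserves-FOIL φ Y φY , fmap-preserves-FOIL ψ Z ψZ
  fmap-preserves-FOIL (ex φ)           X (G , nonEmpty , φXG) =
    let nonEmpty' , FXG≐ = fmap-supplement nonEmpty in
    _ , nonEmpty' , 𝔅.satFOIL-≐ φ FXG≐ (fmap-preserves-FOIL φ (supplement X G) φXG)
  fmap-preserves-FOIL (all φ)          X φX             =
    𝔅.satFOIL-≐ φ fmap-duplicate (fmap-preserves-FOIL φ (duplicate X) φX)

mainTheorem8 : ∀ {σ : Signature} {ℓ : Level} {𝔄 𝔅 : Structure σ ℓ} →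
    ExcludedMiddle (lsuc ℓ) →
    (f : ElementaryTeamEmbedding 𝔄 𝔅) →
    IsIndependenceTeamEmbedding (teamMap f)
mainTheorem8 em f = Transfer.fmap-preserves-FOIL em f
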